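{- Let $\mathfrak{A}=(A;=,+,V_2)$ be a non-standard model of $\mathrm{BA}_2$ and let $c\in A$ be non-standard with $V_2(c)=c$. For a positive rational $q$ written in lowest terms as $q=a/b$ with $a,b$ positive integers, say that $x\in A$ belongs to the galaxy $\mathbf{qc}$ if $\underline{b}x$ and $\underline{a}c$ lie in the same galaxy (where $\underline{m}y$ denotes $y+\cdots+y$, $m$ times). Then for all positive rationals $q_1,q_2$, if $x$ belongs to $\mathbf{q_1c}$ and $y$ belongs to $\mathbf{q_2c}$, then $x+y$ belongs to $\mathbf{(q_1+q_2)c}$.
   Context: $\mathrm{BA}_2=\mathrm{Th}(\mathbb{N};=,+,V_2)$, where $V_2(x)$ is the largest power of $2$ dividing $x$ for $x\neq0$ and $V_2(0)=0$. Standard elements are $0,1,1+1,\ldots$; others are non-standard. For non-standard $u,v$, $u\sim v$ iff the difference between $u$ and $v$ is a standard natural number; the galaxy of $u$ is its $\sim$-class. -}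

module Defs where

open import Data.Nat using (ℕ; zero; suc; _*_; _%_; _/_)
import Data.Nat as N
open import Data.Fin using (Fin; zero; suc)
open import Data.Product using (Σ; _×_; _,_; ∃)
open import Data.Sum using (_⊎_)
open import Data.Empty using (⊥)
open import Relation.Binary.PropositionalEquality using (_≡_)
open import Relation.Nullary using (¬_)
open import Data.Integer using (∣_∣)
open import Data.Rational using (ℚ; ↥_; ↧ₙ_)

-- V₂ on ℕ : the largest power of 2 dividing x (x ≠ 0), and V₂(0) = 0.
-- Computed by repeated halving with fuel (fuel = x suffices).

v2-go : ℕ → ℕ → ℕ
v2-go _       zero    = 0
v2-go zero    (suc _) = 1
v2-go (suc f) (suc m) with suc m % 2
... | zero  = 2 * v2-go f (suc m / 2)
... | suc _ = 1

v2 : ℕ → ℕ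
v2 n = v2-go n n

-- First-order language {=, +, V₂} (with the definable constants 0 and 1
-- as constant symbols, used to name the standard elements 0,1,1+1,...).

data Term (n : ℕ) : Set where
  var  : Fin n → Term n
  𝟘    : Term n
  𝟙    : Term n
  _⊕_  : Term n → Term n → Term n
  V    : Term n → Term n

data Formula : ℕ → Set where
  _≐_  : ∀ {n} → Term n → Term n → Formula n
  ⊥f   : ∀ {n} → Formula n
  _⇒_  : ∀ {n} → Formula n → Formula n → Formula n
  _∧f_ : ∀ {n} → Formula n → Formula n → Formula n
  _∨f_ : ∀ {n} → Formula n → Formula n → Formula n
  ∀f   : ∀ {n} → Formula (suc n) → Formula n
  ∃f   : ∀ {n} → Formula (suc n) → Formula n

Sentence : Set
Sentence = Formula 0

record Structure : Set₁ where
  field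
    A    : Set
    zeroA : A
    oneA  : A
    _+A_ : A → A → A
    V2A  : A → A

module _ (𝔄 : Structure) where
  open Structure 𝔄

  Env : ℕ → Set
  Env n = Fin n → A

  extend : ∀ {n} → A → Env n → Env (suc n)
  extend a ρ zero    = a
  extend a ρ (suc i) = ρ i

  evalT : ∀ {n} → Env n → Term n → A
  evalT ρ (var i) = ρ i
  evalT ρ 𝟘 = zeroA
  evalT ρ 𝟙 = oneA
  evalT ρ (s ⊕ t) = evalT ρ s +A evalT ρ t
  evalT ρ (V t) = V2A (evalT ρ t)

  sat : ∀ {n} → Env n → Formula n → Set
  sat ρ (s ≐ t)  = evalT ρ s ≡ evalT ρ t
  sat ρ ⊥f       = ⊥
  sat ρ (φ ⇒ ψ)  = sat ρ φ → sat ρ ψ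
  sat ρ (φ ∧f ψ) = sat ρ φ × sat ρ ψ
  sat ρ (φ ∨f ψ) = sat ρ φ ⊎ sat ρ ψ
  sat ρ (∀f φ)   = (a : A) → sat (extend a ρ) φ
  sat ρ (∃f φ)   = Σ A λ a → sat (extend a ρ) φ

  emptyEnv : Env 0
  emptyEnv ()

  _⊨_ : Sentence → Set
  _⊨_ φ = sat emptyEnv φ

ℕ-str : Structure
ℕ-str = record { A = ℕ ; zeroA = 0 ; oneA = 1 ; _+A_ = N._+_ ; V2A = v2 }

-- 𝔄 is a model of BA₂ = Th(ℕ; =, +, V₂).
IsModelBA₂ : Structure → Set
IsModelBA₂ 𝔄 = (φ : Sentence) → _⊨_ ℕ-str φ → _⊨_ 𝔄 φ

module _ (𝔄 : Structure) where
  open Structure 𝔄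

  num : ℕ → A
  num zero    = zeroA
  num (suc zero) = oneA
  num (suc (suc k)) = num (suc k) +A oneA

  NonStandard : A → Set
  NonStandard x = (k : ℕ) → ¬ (x ≡ num k)

  smul : ℕ → A → A
  smul zero y = zeroA
  smul (suc zero) y = y
  smul (suc (suc m)) y = smul (suc m) y +A y

  SameGalaxy : A → A → Set
  SameGalaxy u v = NonStandard u × NonStandard v ×
                   ∃ λ k → (u ≡ v +A num k) ⊎ (v ≡ u +A num k)

  InGalaxy : ℚ → A → A → Set
  InGalaxy q c x = SameGalaxy (smul (↧ₙ q) x) (smul ∣ ↥ q ∣ c)

-- Say u ∼ v when u + k = v + l for standard k, l.  The first-order facts that (A; +, 0) is a
-- cancellative commutative monoid, totally preordered by u ≤ u + t, in which everything below a
-- standard element is standard, make ∼ a congruence for + and for multiplication by standard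
-- n, which can moreover be cancelled when n ≠ 0.  For q₁ = a₁/b₁, q₂ = a₂/b₂ and
-- q₁ + q₂ = a/b one then computes
--   b₁b₂·b(x + y) = b·(b₂·b₁x + b₁·b₂y) ∼ b·(a₁b₂ + a₂b₁)c = b₁b₂·ac,
-- and cancelling b₁b₂ gives b(x + y) ∼ ac.

module Submission where

open import Defs
open import Data.Product using (_×_)
open import Relation.Binary.PropositionalEquality using (_≡_)
open import Data.Rational using (ℚ; Positive; _+_)

open import Algebra.Bundles using (CommutativeMonoid)
open import Algebra.Definitions using (Associative; Commutative; RightIdentity; LeftCancellative)
open import Algebra.Structures using (IsCommutativeMonoid)
open import Algebra.Structures.Biased using (isCommutativeMonoidʳ)
import Algebra.Properties.CommutativeMonoid.Mult as CommutativeMonoidMult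
import Algebra.Properties.CommutativeSemigroup as CommutativeSemigroupProperties
import Algebra.Properties.Monoid.Mult.TCOptimised as MonoidMultTCOptimised
open import Data.Fin using () renaming (zero to fzero; suc to fsuc)
open import Data.Integer as ℤ using (∣_∣; +[1+_])
open import Data.Integer.Properties using (abs-*)
open import Data.Nat as ℕ using (ℕ; zero; suc; _≤_; NonZero)
open import Data.Nat.Properties as ℕ using (m*n≢0)
open import Data.Product using (_,_; ∃; ∃₂)
open import Data.Rational using (mkℚ; ↥_; ↧_; ↧ₙ_)
open import Data.Rational.Properties using (toℚᵘ-homo-+; ↥ᵘ-toℚᵘ; ↧ᵘ-toℚᵘ; pos+pos⇒pos)
import Data.Rational.Unnormalised as ℚᵘ
open import Data.Sum using (_⊎_; inj₁; inj₂)
open import Level using (0ℓ)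
open import Function using (_∘_; case_of_)
open import Relation.Binary.PropositionalEquality
  using (refl; sym; trans; cong; cong₂; subst; subst₂; isEquivalence; module ≡-Reasoning)
open import Relation.Nullary using (¬_; yes; no)

open ≡-Reasoning

↥+-cross : ∀ p q →
  ↥ (p + q) ℤ.* (↧ p ℤ.* ↧ q) ≡ (↥ p ℤ.* ↧ q ℤ.+ ↥ q ℤ.* ↧ p) ℤ.* ↧ (p + q)
↥+-cross p@record{} q@record{} with toℚᵘ-homo-+ p q
... | ℚᵘ.*≡* eq =
  subst₂ (λ n d → n ℤ.* (↧ p ℤ.* ↧ q) ≡ (↥ p ℤ.* ↧ q ℤ.+ ↥ q ℤ.* ↧ p) ℤ.* d)
         (↥ᵘ-toℚᵘ (p + q)) (↧ᵘ-toℚᵘ (p + q)) eq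

∣↥+∣-cross : ∀ p q → Positive p → Positive q →
  ∣ ↥ (p + q) ∣ ℕ.* (↧ₙ p ℕ.* ↧ₙ q) ≡ (∣ ↥ p ∣ ℕ.* ↧ₙ q ℕ.+ ∣ ↥ q ∣ ℕ.* ↧ₙ p) ℕ.* ↧ₙ (p + q)
-- With positive numerators the right-hand side of ↥+-cross computes to + of a natural number.
∣↥+∣-cross p@(mkℚ +[1+ _ ] _ _) q@(mkℚ +[1+ _ ] _ _) _ _ =
  trans (sym (abs-* (↥ (p + q)) (↧ p ℤ.* ↧ q))) (cong ∣_∣ (↥+-cross p q))

∣↥∣-nonZero : ∀ q → Positive q → NonZero ∣ ↥ q ∣
∣↥∣-nonZero (mkℚ +[1+ _ ] _ _) _ = _

numeral : ∀ {n} → ℕ → Term n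
numeral zero          = 𝟘
numeral (suc zero)    = 𝟙
numeral (suc (suc k)) = numeral (suc k) ⊕ 𝟙

evalT-numeral : ∀ 𝔄 {n} (ρ : Env 𝔄 n) k → evalT 𝔄 ρ (numeral k) ≡ num 𝔄 k
evalT-numeral 𝔄 ρ zero          = refl
evalT-numeral 𝔄 ρ (suc zero)    = refl
evalT-numeral 𝔄 ρ (suc (suc k)) =
  cong (λ z → Structure._+A_ 𝔄 z (Structure.oneA 𝔄)) (evalT-numeral 𝔄 ρ (suc k))

num-ℕ : ∀ k → num ℕ-str k ≡ k
num-ℕ zero          = refl
num-ℕ (suc zero)    = refl
num-ℕ (suc (suc k)) = trans (cong (ℕ._+ 1) (num-ℕ (suc k))) (ℕ.+-comm (suc k) 1)

infix 4 _∈[0,_]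

_∈[0,_] : ∀ {n} → Term n → ℕ → Formula n
t ∈[0, zero ]  = t ≐ numeral 0
t ∈[0, suc k ] = (t ≐ numeral (suc k)) ∨f (t ∈[0, k ])

≤⇒sat-∈[0,] : ∀ {n} (ρ : Env ℕ-str n) t k → evalT ℕ-str ρ t ≤ k → sat ℕ-str ρ (t ∈[0, k ])
≤⇒sat-∈[0,] ρ t zero    t≤0 = ℕ.n≤0⇒n≡0 t≤0
≤⇒sat-∈[0,] ρ t (suc k) t≤k with evalT ℕ-str ρ t ℕ.≟ suc k
... | yes t≡k = inj₁ (trans t≡k (sym (trans (evalT-numeral ℕ-str ρ (suc k)) (num-ℕ (suc k)))))
... | no  t≢k = inj₂ (≤⇒sat-∈[0,] ρ t k (ℕ.s≤s⁻¹ (ℕ.≤∧≢⇒< t≤k t≢k)))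

sat-∈[0,]⇒num : ∀ 𝔄 {n} (ρ : Env 𝔄 n) t k → sat 𝔄 ρ (t ∈[0, k ]) → ∃ λ j → evalT 𝔄 ρ t ≡ num 𝔄 j
sat-∈[0,]⇒num 𝔄 ρ t zero    t≡0        = 0 , t≡0
sat-∈[0,]⇒num 𝔄 ρ t (suc k) (inj₁ t≡k) = suc k , trans t≡k (evalT-numeral 𝔄 ρ (suc k))
sat-∈[0,]⇒num 𝔄 ρ t (suc k) (inj₂ t≤k) = sat-∈[0,]⇒num 𝔄 ρ t k t≤k

v₀ : ∀ {n} → Term (suc n)
v₀ = var fzero

v₁ : ∀ {n} → Term (suc (suc n))
v₁ = var (fsuc fzero)

v₂ : ∀ {n} → Term (suc (suc (suc n)))
v₂ = var (fsuc (fsuc fzero))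

assoc-sentence comm-sentence identityʳ-sentence cancelˡ-sentence total-sentence : Sentence
assoc-sentence     = ∀f (∀f (∀f (((v₂ ⊕ v₁) ⊕ v₀) ≐ (v₂ ⊕ (v₁ ⊕ v₀)))))
comm-sentence      = ∀f (∀f ((v₁ ⊕ v₀) ≐ (v₀ ⊕ v₁)))
identityʳ-sentence = ∀f ((v₀ ⊕ 𝟘) ≐ v₀)
cancelˡ-sentence   = ∀f (∀f (∀f (((v₂ ⊕ v₁) ≐ (v₂ ⊕ v₀)) ⇒ (v₁ ≐ v₀))))
total-sentence     = ∀f (∀f (∃f ((v₂ ≐ (v₁ ⊕ v₀)) ∨f (v₁ ≐ (v₂ ⊕ v₀)))))

downClosed-sentence : ℕ → Sentence
downClosed-sentence k = ∀f (∀f (((v₁ ⊕ v₀) ≐ numeral k) ⇒ (v₁ ∈[0, k ])))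

ℕ⊨total : ℕ-str ⊨ total-sentence
ℕ⊨total m n with ℕ.≤-total n m
... | inj₁ n≤m = m ℕ.∸ n , inj₁ (sym (ℕ.m+[n∸m]≡n n≤m))
... | inj₂ m≤n = n ℕ.∸ m , inj₂ (sym (ℕ.m+[n∸m]≡n m≤n))

ℕ⊨downClosed : ∀ k → ℕ-str ⊨ downClosed-sentence k
ℕ⊨downClosed k m n m+n≡k = ≤⇒sat-∈[0,] _ v₁ k
  (subst (m ≤_) (trans m+n≡k (trans (evalT-numeral ℕ-str _ k) (num-ℕ k))) (ℕ.m≤m+n m n))

module Model (𝔄 : Structure) (𝔄⊨BA₂ : IsModelBA₂ 𝔄) where
  open Structure 𝔄 using (A; oneA) renaming (zeroA to ε)

  infixl 6 _∙_

  _∙_ : A → A → A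
  _∙_ = Structure._+A_ 𝔄

  ∙-assoc : Associative _≡_ _∙_
  ∙-assoc = 𝔄⊨BA₂ assoc-sentence ℕ.+-assoc

  ∙-comm : Commutative _≡_ _∙_
  ∙-comm = 𝔄⊨BA₂ comm-sentence ℕ.+-comm

  ∙-identityʳ : RightIdentity _≡_ ε _∙_
  ∙-identityʳ = 𝔄⊨BA₂ identityʳ-sentence ℕ.+-identityʳ

  ∙-cancelˡ : LeftCancellative _≡_ _∙_
  ∙-cancelˡ = 𝔄⊨BA₂ cancelˡ-sentence ℕ.+-cancelˡ-≡

  ∙-cancelʳ : ∀ u v w → u ∙ w ≡ v ∙ w → u ≡ v
  ∙-cancelʳ u v w eq = ∙-cancelˡ w u v (trans (∙-comm w u) (trans eq (∙-comm v w)))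

  ∙-total : ∀ u v → ∃ λ t → u ≡ v ∙ t ⊎ v ≡ u ∙ t
  ∙-total = 𝔄⊨BA₂ total-sentence ℕ⊨total

  ∙-isCommutativeMonoid : IsCommutativeMonoid _≡_ _∙_ ε
  ∙-isCommutativeMonoid = isCommutativeMonoidʳ record
    { isSemigroup = record
      { isMagma = record { isEquivalence = isEquivalence ; ∙-cong = cong₂ _∙_ }
      ; assoc   = ∙-assoc
      }
    ; identityʳ = ∙-identityʳ
    ; comm      = ∙-comm
    }

  ∙-commutativeMonoid : CommutativeMonoid 0ℓ 0ℓ
  ∙-commutativeMonoid = record { isCommutativeMonoid = ∙-isCommutativeMonoid }

  open CommutativeMonoid ∙-commutativeMonoid using (monoid; commutativeSemigroup)
  open CommutativeMonoidMult ∙-commutativeMonoid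
    using (×-homo-+; ×-assocˡ; ×-distrib-+) renaming (_×_ to infixr 8 _·_)
  open MonoidMultTCOptimised monoid using (×ᵤ≈×) renaming (_×_ to _·′_)
  open CommutativeSemigroupProperties commutativeSemigroup using (interchange; x∙yz≈xz∙y)

  smul≡· : ∀ n x → smul 𝔄 n x ≡ n · x
  smul≡· n x = trans (smul≡·′ n) (sym (×ᵤ≈× n x))
    where
    smul≡·′ : ∀ n → smul 𝔄 n x ≡ n ·′ x
    smul≡·′ zero          = refl
    smul≡·′ (suc zero)    = refl
    smul≡·′ (suc (suc n)) = cong (_∙ x) (smul≡·′ (suc n))

  std : ℕ → A
  std k = k · oneA

  num≡std : ∀ k → num 𝔄 k ≡ std k
  num≡std k = trans (num≡smul k) (smul≡· k oneA)
    where
    num≡smul : ∀ k → num 𝔄 k ≡ smul 𝔄 k oneA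
    num≡smul zero          = refl
    num≡smul (suc zero)    = refl
    num≡smul (suc (suc k)) = cong (_∙ oneA) (num≡smul (suc k))

  std-homo-+ : ∀ m n → std (m ℕ.+ n) ≡ std m ∙ std n
  std-homo-+ = ×-homo-+ oneA

  ·-std : ∀ m n → m · std n ≡ std (m ℕ.* n)
  ·-std = ×-assocˡ oneA

  ·-comm : ∀ m n x → m · (n · x) ≡ n · (m · x)
  ·-comm m n x = begin
    m · (n · x)    ≡⟨ ×-assocˡ x m n ⟩
    (m ℕ.* n) · x  ≡⟨ cong (_· x) (ℕ.*-comm m n) ⟩
    (n ℕ.* m) · x  ≡⟨ ×-assocˡ x n m ⟨
    n · (m · x)    ∎

  IsStd : A → Set
  IsStd x = ∃ λ k → x ≡ std k

  nonStandard⇒¬IsStd : ∀ {x} → NonStandard 𝔄 x → ¬ IsStd x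
  nonStandard⇒¬IsStd ns (k , x≡k) = ns k (trans x≡k (sym (num≡std k)))

  ¬IsStd⇒nonStandard : ∀ {x} → ¬ IsStd x → NonStandard 𝔄 x
  ¬IsStd⇒nonStandard ¬std k x≡k = ¬std (k , trans x≡k (num≡std k))

  isStd-∙ˡ : ∀ u v → IsStd (u ∙ v) → IsStd u
  isStd-∙ˡ u v (k , u∙v≡k) =
    let j , u≡j = sat-∈[0,]⇒num 𝔄 _ v₁ k (𝔄⊨BA₂ (downClosed-sentence k) (ℕ⊨downClosed k) u v
                    (trans u∙v≡k (sym (trans (evalT-numeral 𝔄 _ k) (num≡std k)))))
    in j , trans u≡j (num≡std j)

  isStd-·⁻¹ : ∀ n .{{_ : NonZero n}} x → IsStd (n · x) → IsStd x
  isStd-·⁻¹ (suc n) x = isStd-∙ˡ x (n · x)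

  infix 4 _∼_

  _∼_ : A → A → Set
  u ∼ v = ∃₂ λ k l → u ∙ std k ≡ v ∙ std l

  ∼-sym : ∀ {u v} → u ∼ v → v ∼ u
  ∼-sym (k , l , eq) = l , k , sym eq

  ∼-∙ : ∀ {u v u′ v′} → u ∼ v → u′ ∼ v′ → u ∙ u′ ∼ v ∙ v′
  ∼-∙ {u} {v} {u′} {v′} (k , l , eq) (k′ , l′ , eq′) = k ℕ.+ k′ , l ℕ.+ l′ , (begin
    (u ∙ u′) ∙ std (k ℕ.+ k′)      ≡⟨ cong ((u ∙ u′) ∙_) (std-homo-+ k k′) ⟩
    (u ∙ u′) ∙ (std k ∙ std k′)    ≡⟨ interchange u u′ (std k) (std k′) ⟩
    (u ∙ std k) ∙ (u′ ∙ std k′)    ≡⟨ cong₂ _∙_ eq eq′ ⟩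
    (v ∙ std l) ∙ (v′ ∙ std l′)    ≡⟨ interchange v (std l) v′ (std l′) ⟩
    (v ∙ v′) ∙ (std l ∙ std l′)    ≡⟨ cong ((v ∙ v′) ∙_) (std-homo-+ l l′) ⟨
    (v ∙ v′) ∙ std (l ℕ.+ l′)      ∎)

  ·-distrib-∙std : ∀ n u k → n · (u ∙ std k) ≡ n · u ∙ std (n ℕ.* k)
  ·-distrib-∙std n u k = trans (×-distrib-+ u (std k) n) (cong (n · u ∙_) (·-std n k))

  ∼-· : ∀ n {u v} → u ∼ v → n · u ∼ n · v
  ∼-· n {u} {v} (k , l , eq) = n ℕ.* k , n ℕ.* l , (begin
    n · u ∙ std (n ℕ.* k)  ≡⟨ ·-distrib-∙std n u k ⟨
    n · (u ∙ std k)        ≡⟨ cong (n ·_) eq ⟩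
    n · (v ∙ std l)        ≡⟨ ·-distrib-∙std n v l ⟩
    n · v ∙ std (n ℕ.* l)  ∎)

  offset⇒∼ : ∀ {u v} k → u ≡ v ∙ std k → u ∼ v
  offset⇒∼ {u} k u≡v+k = 0 , k , trans (∙-identityʳ u) u≡v+k

  ∼-·⁻¹ : ∀ n .{{_ : NonZero n}} {u v} → n · u ∼ n · v → u ∼ v
  ∼-·⁻¹ n {u} {v} nu∼nv = case ∙-total u v of λ where
      (t , inj₁ u≡v+t) → ∼-·⁻¹-offset nu∼nv u≡v+t
      (t , inj₂ v≡u+t) → ∼-sym (∼-·⁻¹-offset (∼-sym nu∼nv) v≡u+t)
    where
    ∼-·⁻¹-offset : ∀ {u v t} → n · u ∼ n · v → u ≡ v ∙ t → u ∼ v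
    ∼-·⁻¹-offset {u} {v} {t} (k , l , eq) u≡v+t =
      let j , n·t≡j = isStd-∙ˡ (n · t) (std k) (l , ∙-cancelˡ (n · v) _ _ (begin
            n · v ∙ (n · t ∙ std k)  ≡⟨ ∙-assoc (n · v) (n · t) (std k) ⟨
            (n · v ∙ n · t) ∙ std k  ≡⟨ cong (_∙ std k) (×-distrib-+ v t n) ⟨
            n · (v ∙ t) ∙ std k      ≡⟨ cong (λ z → n · z ∙ std k) u≡v+t ⟨
            n · u ∙ std k            ≡⟨ eq ⟩
            n · v ∙ std l            ∎))
          i , t≡i = isStd-·⁻¹ n t (j , n·t≡j)
      in offset⇒∼ i (trans u≡v+t (cong (v ∙_) t≡i))

  isStd-∼ : ∀ {u v} → u ∼ v → IsStd u → IsStd v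
  isStd-∼ {u} {v} (k , l , eq) (m , u≡m) = isStd-∙ˡ v (std l) (m ℕ.+ k , (begin
    v ∙ std l      ≡⟨ eq ⟨
    u ∙ std k      ≡⟨ cong (_∙ std k) u≡m ⟩
    std m ∙ std k  ≡⟨ std-homo-+ m k ⟨
    std (m ℕ.+ k)  ∎))

  nonStandard-∼ : ∀ {u v} → NonStandard 𝔄 v → u ∼ v → NonStandard 𝔄 u
  nonStandard-∼ ns u∼v = ¬IsStd⇒nonStandard (nonStandard⇒¬IsStd ns ∘ isStd-∼ u∼v)

  nonStandard-· : ∀ n .{{_ : NonZero n}} {x} → NonStandard 𝔄 x → NonStandard 𝔄 (n · x)
  nonStandard-· n {x} ns = ¬IsStd⇒nonStandard (nonStandard⇒¬IsStd ns ∘ isStd-·⁻¹ n x)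

  ∙std-cancel : ∀ {u v} k o → u ∙ std k ≡ v ∙ std (k ℕ.+ o) → u ≡ v ∙ std o
  ∙std-cancel {u} {v} k o eq = ∙-cancelʳ u (v ∙ std o) (std k) (begin
    u ∙ std k              ≡⟨ eq ⟩
    v ∙ std (k ℕ.+ o)      ≡⟨ cong (v ∙_) (std-homo-+ k o) ⟩
    v ∙ (std k ∙ std o)    ≡⟨ x∙yz≈xz∙y v (std k) (std o) ⟩
    v ∙ std o ∙ std k      ∎)

  ∼⇒offset : ∀ {u v} → u ∼ v → ∃ λ o → u ≡ v ∙ num 𝔄 o ⊎ v ≡ u ∙ num 𝔄 o
  ∼⇒offset {u} {v} (k , l , eq) with ℕ.≤-total k l
  ... | inj₁ k≤l with ℕ.m≤n⇒∃[o]m+o≡n k≤l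
  ...   | o , refl = o , inj₁ (trans (∙std-cancel k o eq) (cong (v ∙_) (sym (num≡std o))))
  ∼⇒offset {u} {v} (k , l , eq) | inj₂ l≤k with ℕ.m≤n⇒∃[o]m+o≡n l≤k
  ...   | o , refl = o , inj₂ (trans (∙std-cancel l o (sym eq)) (cong (u ∙_) (sym (num≡std o))))

  sameGalaxy⇒∼ : ∀ {u v} → SameGalaxy 𝔄 u v → u ∼ v
  sameGalaxy⇒∼ {u} {v} (_ , _ , k , inj₁ u≡v+k) =
    offset⇒∼ k (trans u≡v+k (cong (v ∙_) (num≡std k)))
  sameGalaxy⇒∼ {u} {v} (_ , _ , k , inj₂ v≡u+k) =
    ∼-sym (offset⇒∼ k (trans v≡u+k (cong (u ∙_) (num≡std k))))

  ∼⇒sameGalaxy : ∀ {u v} → NonStandard 𝔄 v → u ∼ v → SameGalaxy 𝔄 u v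
  ∼⇒sameGalaxy ns u∼v = nonStandard-∼ ns u∼v , ns , ∼⇒offset u∼v

  ∼-fraction-+ : ∀ a₁ b₁ a₂ b₂ a b .{{_ : NonZero b₁}} .{{_ : NonZero b₂}} {c x y} →
    a ℕ.* (b₁ ℕ.* b₂) ≡ (a₁ ℕ.* b₂ ℕ.+ a₂ ℕ.* b₁) ℕ.* b →
    b₁ · x ∼ a₁ · c → b₂ · y ∼ a₂ · c → b · (x ∙ y) ∼ a · c
  ∼-fraction-+ a₁ b₁ a₂ b₂ a b {c} {x} {y} cross x∼a₁c y∼a₂c =
    ∼-·⁻¹ d {{m*n≢0 b₁ b₂}} (subst₂ _∼_ (·-comm b d (x ∙ y)) scale (∼-· b sum))
    where
    d n : ℕ
    d = b₁ ℕ.* b₂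
    n = a₁ ℕ.* b₂ ℕ.+ a₂ ℕ.* b₁

    sum : d · (x ∙ y) ∼ n · c
    sum = subst₂ _∼_
      (begin
        b₂ · b₁ · x ∙ b₁ · b₂ · y  ≡⟨ cong (_∙ b₁ · b₂ · y) (·-comm b₂ b₁ x) ⟩
        b₁ · b₂ · x ∙ b₁ · b₂ · y  ≡⟨ cong₂ _∙_ (×-assocˡ x b₁ b₂) (×-assocˡ y b₁ b₂) ⟩
        d · x ∙ d · y              ≡⟨ ×-distrib-+ x y d ⟨
        d · (x ∙ y)                ∎)
      (begin
        b₂ · a₁ · c ∙ b₁ · a₂ · c            ≡⟨ cong₂ _∙_ (×-assocˡ c b₂ a₁) (×-assocˡ c b₁ a₂) ⟩
        (b₂ ℕ.* a₁) · c ∙ (b₁ ℕ.* a₂) · c    ≡⟨ ×-homo-+ c (b₂ ℕ.* a₁) (b₁ ℕ.* a₂) ⟨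
        (b₂ ℕ.* a₁ ℕ.+ b₁ ℕ.* a₂) · c        ≡⟨ cong (_· c) (cong₂ ℕ._+_ (ℕ.*-comm b₂ a₁) (ℕ.*-comm b₁ a₂)) ⟩
        n · c                                ∎)
      (∼-∙ (∼-· b₂ x∼a₁c) (∼-· b₁ y∼a₂c))

    scale : b · n · c ≡ d · a · c
    scale = begin
      b · n · c        ≡⟨ ×-assocˡ c b n ⟩
      (b ℕ.* n) · c    ≡⟨ cong (_· c) (trans (ℕ.*-comm b n) (trans (sym cross) (ℕ.*-comm a d))) ⟩
      (d ℕ.* a) · c    ≡⟨ ×-assocˡ c d a ⟨
      d · a · c        ∎

  inGalaxy⇒∼ : ∀ q {c x} → InGalaxy 𝔄 q c x → ↧ₙ q · x ∼ ∣ ↥ q ∣ · c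
  inGalaxy⇒∼ q {c} {x} x∈qc = subst₂ _∼_ (smul≡· (↧ₙ q) x) (smul≡· ∣ ↥ q ∣ c) (sameGalaxy⇒∼ x∈qc)

  ∼⇒inGalaxy : ∀ q {c x} .{{_ : NonZero ∣ ↥ q ∣}} → NonStandard 𝔄 c →
    ↧ₙ q · x ∼ ∣ ↥ q ∣ · c → InGalaxy 𝔄 q c x
  ∼⇒inGalaxy q {c} {x} ns x∼qc = ∼⇒sameGalaxy
    (subst (NonStandard 𝔄) (sym (smul≡· ∣ ↥ q ∣ c)) (nonStandard-· ∣ ↥ q ∣ ns))
    (subst₂ _∼_ (sym (smul≡· (↧ₙ q) x)) (sym (smul≡· ∣ ↥ q ∣ c)) x∼qc)

mainTheorem6 : (𝔄 : Structure) → IsModelBA₂ 𝔄 →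
    (c : Structure.A 𝔄) → NonStandard 𝔄 c → Structure.V2A 𝔄 c ≡ c →
    (q₁ q₂ : ℚ) → Positive q₁ → Positive q₂ →
    (x y : Structure.A 𝔄) → InGalaxy 𝔄 q₁ c x → InGalaxy 𝔄 q₂ c y →
    InGalaxy 𝔄 (q₁ + q₂) c (Structure._+A_ 𝔄 x y)
mainTheorem6 𝔄 𝔄⊨BA₂ c c-nonStd _ q₁ q₂ q₁>0 q₂>0 x y x∈q₁c y∈q₂c =
  ∼⇒inGalaxy (q₁ + q₂) {{∣↥∣-nonZero (q₁ + q₂) q₁+q₂>0}} c-nonStd
    (∼-fraction-+ ∣ ↥ q₁ ∣ (↧ₙ q₁) ∣ ↥ q₂ ∣ (↧ₙ q₂) ∣ ↥ (q₁ + q₂) ∣ (↧ₙ (q₁ + q₂))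
      (∣↥+∣-cross q₁ q₂ q₁>0 q₂>0) (inGalaxy⇒∼ q₁ x∈q₁c) (inGalaxy⇒∼ q₂ y∈q₂c))
  where
  open Model 𝔄 𝔄⊨BA₂

  q₁+q₂>0 : Positive (q₁ + q₂)
  q₁+q₂>0 = pos+pos⇒pos q₁ {{q₁>0}} q₂ {{q₂>0}}
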